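{- Let $\mathbb{K}$ be a field of characteristic $0$, $\ell\ge2$, and let $N=(N_2,\ldots,N_\ell)$ be finite subsets of $\mathbb{K}$ with $N_2\subseteq N_3\subseteq\cdots\subseteq N_\ell$. Let $\mathcal{I}_N$ be the central arrangement in $\mathbb{K}^{\ell+1}$ (coordinates $x_1,\ldots,x_\ell,z$) consisting of $\{z=0\}$, $\{x_1-x_j-az=0\}$ ($2\le j\le\ell$, $a\in N_j$), $\{x_i-x_j=0\}$ ($2\le i<j\le\ell$). Then the derivations \[\theta_0=\sum_{i=1}^{\ell}\frac{\partial}{\partial x_i},\qquad\theta_1=\sum_{i=1}^{\ell}x_i\frac{\partial}{\partial x_i}+z\frac{\partial}{\partial z},\] \[\theta_k=\sum_{s=2}^{k}\Big(\prod_{a\in N_k}(x_1-x_s-az)\prod_{t=k+1}^{\ell}(x_s-x_t)\Big)\frac{\partial}{\partial x_s}\quad(2\le k\le\ell)\] belong to $D(\mathcal{I}_N)$.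
   Context: $S=\mathbb{K}[x_1,\ldots,x_\ell,z]$, and $D(\mathcal{A})=\{\theta\in\mathrm{Der}_{\mathbb{K}}(S)\mid\theta(\alpha_H)\in\alpha_H S\ \text{for all }H\in\mathcal{A}\}$, with $\alpha_H$ a linear form defining $H$. -}

module Defs where

open import Level using (Level; _⊔_) renaming (suc to lsuc)
open import Algebra.Bundles using (CommutativeRing)
open import Data.Nat as ℕ using (ℕ; zero; suc; _∸_; _≤_; _<_; _<?_)
open import Data.Fin using (Fin; fromℕ<; toℕ)
open import Data.List as L using (List; []; _∷_; upTo; concatMap; foldr)
open import Data.List.Membership.Propositional as PM using ()
open import Data.Product using (∃; Σ; _×_; _,_)
open import Relation.Nullary using (¬_; yes; no)

record Field (c ℓ : Level) : Set (lsuc (c ⊔ ℓ)) where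
  field
    commutativeRing : CommutativeRing c ℓ
  open CommutativeRing commutativeRing public
  field
    0≉1 : ¬ (0# ≈ 1#)
    inverse : ∀ x → ¬ (x ≈ 0#) → ∃ λ y → (x * y) ≈ 1#

module _ {c ℓ} (K : Field c ℓ) where
  open Field K

  natK : ℕ → Carrier
  natK zero = 0#
  natK (suc n) = 1# + natK n

  CharZero : Set ℓ
  CharZero = ∀ n → ¬ (natK (suc n) ≈ 0#)

-- The polynomial ring K[v_0,…,v_{m-1}], presented as the free
-- commutative K-algebra on m generators: polynomial expressions modulo
-- the congruence generated by the commutative-ring axioms and the fact
-- that constants form a copy of K.

module Poly {c ℓ} (K : Field c ℓ) where
  open Field K

  infixl 6 _⊕_
  infixl 7 _⊗_
  infix 4 _≋_

  data P (m : ℕ) : Set c where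
    con : Carrier → P m
    var : Fin m → P m
    _⊕_ : P m → P m → P m
    _⊗_ : P m → P m → P m
    ⊝_  : P m → P m

  𝟘 𝟙 : ∀ {m} → P m
  𝟘 = con 0#
  𝟙 = con 1#

  _⊖_ : ∀ {m} → P m → P m → P m
  p ⊖ q = p ⊕ (⊝ q)

  data _≋_ {m : ℕ} : P m → P m → Set (c ⊔ ℓ) where
    ≋-refl  : ∀ {p} → p ≋ p
    ≋-sym   : ∀ {p q} → p ≋ q → q ≋ p
    ≋-trans : ∀ {p q r} → p ≋ q → q ≋ r → p ≋ r
    ⊕-cong  : ∀ {p p′ q q′} → p ≋ p′ → q ≋ q′ → p ⊕ q ≋ p′ ⊕ q′
    ⊗-cong  : ∀ {p p′ q q′} → p ≋ p′ → q ≋ q′ → p ⊗ q ≋ p′ ⊗ q′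
    ⊝-cong  : ∀ {p q} → p ≋ q → ⊝ p ≋ ⊝ q
    ⊕-assoc : ∀ p q r → (p ⊕ q) ⊕ r ≋ p ⊕ (q ⊕ r)
    ⊕-comm  : ∀ p q → p ⊕ q ≋ q ⊕ p
    ⊕-idʳ   : ∀ p → p ⊕ 𝟘 ≋ p
    ⊝-invʳ  : ∀ p → p ⊕ (⊝ p) ≋ 𝟘
    ⊗-assoc : ∀ p q r → (p ⊗ q) ⊗ r ≋ p ⊗ (q ⊗ r)
    ⊗-comm  : ∀ p q → p ⊗ q ≋ q ⊗ p
    ⊗-idʳ   : ∀ p → p ⊗ 𝟙 ≋ p
    ⊗-distribʳ : ∀ p q r → (p ⊕ q) ⊗ r ≋ (p ⊗ r) ⊕ (q ⊗ r)
    con-cong : ∀ {a b} → a ≈ b → con a ≋ con b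
    con-+   : ∀ a b → con (a + b) ≋ con a ⊕ con b
    con-*   : ∀ a b → con (a * b) ≋ con a ⊗ con b
    con--   : ∀ a → con (- a) ≋ ⊝ con a

  _∈⟨_⟩ : ∀ {m} → P m → P m → Set (c ⊔ ℓ)
  f ∈⟨ g ⟩ = Σ (P _) λ q → f ≋ g ⊗ q

  prod : ∀ {m} → List (P m) → P m
  prod = foldr _⊗_ 𝟙

  -- A K-derivation of K[v] is determined by its values on the generators;
  -- θ : Fin m → P m gives θ(v_i), and apply θ is the unique derivation
  -- (Leibniz rule) with these values.
  Der : ℕ → Set c
  Der m = Fin m → P m

  apply : ∀ {m} → Der m → P m → P m
  apply θ (con a) = 𝟘
  apply θ (var i) = θ i
  apply θ (p ⊕ q) = apply θ p ⊕ apply θ q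
  apply θ (p ⊗ q) = (apply θ p ⊗ q) ⊕ (p ⊗ apply θ q)
  apply θ (⊝ p) = ⊝ apply θ p

  -- Module of logarithmic derivations of an arrangement given by a list of
  -- defining linear forms α_H.
  _∈D_ : ∀ {m} → Der m → List (P m) → Set (c ⊔ ℓ)
  θ ∈D 𝒜 = ∀ α → α PM.∈ 𝒜 → apply θ α ∈⟨ α ⟩

-- The arrangement I_N and the derivations θ_k.
-- S = K[z, x_1, …, x_ℓ] with generator index 0 = z and index i = x_i
-- (1 ≤ i ≤ ℓ).  So S = P (suc ℓ).

-- inclusive range [a, b] of natural numbers
range : ℕ → ℕ → List ℕ
range a b = L.map (a ℕ.+_) (upTo (suc b ∸ a))

module IN {c ℓ′} (K : Field c ℓ′) (ℓ : ℕ) where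
  open Field K
  open Poly K public

  S : Set c
  S = P (suc ℓ)

  z : S
  z = var Data.Fin.zero

  -- x i for 1 ≤ i ≤ ℓ ; (out of range indices give 0, never used)
  x : ℕ → S
  x i with i <? suc ℓ
  ... | yes i<  = var (fromℕ< i<)
  ... | no _    = 𝟘

  -- N : the family N_2, …, N_ℓ (only indices 2..ℓ are used);
  -- finite subsets of K given as duplicate-free lists.
  module _ (N : ℕ → List Carrier) where

    arrangement : List S
    arrangement =
      z ∷ (concatMap (λ j → L.map (λ a → (x 1 ⊖ x j) ⊖ (con a ⊗ z)) (N j)) (range 2 ℓ)
           L.++ concatMap (λ j → L.map (λ i → x i ⊖ x j) (range 2 (j ∸ 1))) (range 2 ℓ))

    θ₀ : Der (suc ℓ)
    θ₀ i with toℕ i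
    ... | zero = 𝟘
    ... | suc _ = 𝟙

    θ₁ : Der (suc ℓ)
    θ₁ i = var i

    θ : ℕ → Der (suc ℓ)
    θ k i with toℕ i
    ... | s with 2 ℕ.≤? s | s ℕ.≤? k
    ...   | yes _ | yes _ =
              prod (L.map (λ a → (x 1 ⊖ x s) ⊖ (con a ⊗ z)) (N k))
            ⊗ prod (L.map (λ t → x s ⊖ x t) (range (suc k) ℓ))
    ...   | _ | _ = 𝟘

-- Each θ is tangent to every hyperplane H of I_N, i.e. α_H divides θ(α_H).
-- θ₀ annihilates every defining form and θ₁, the Euler derivation, fixes
-- it.  On
-- x₁ - x_j - az only -θ_k(x_j) survives, and it has the factor
-- x₁ - x_j - az because a ∈ N_j ⊆ N_k.  On x_i - x_j (i < j) the
-- coefficients of ∂/∂x_i and ∂/∂x_j are the same expression in x_i resp.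
-- x_j, hence congruent modulo x_i - x_j; when i ≤ k < j the coefficient
-- of ∂/∂x_i has x_i - x_j itself as a factor and that of ∂/∂x_j is 0.
module Submission where

open import Defs
open import Level using (Level; _⊔_)
open import Algebra.Bundles using (CommutativeRing)
open import Data.Nat as ℕ
  using (ℕ; zero; suc; _∸_; _≤_; _<_; _≤′_; ≤′-refl; ≤′-step; s≤s; _<?_; _≤?_)
import Data.Nat.Properties as ℕₚ
open import Data.Fin using (fromℕ<; toℕ)
open import Data.Fin.Properties using (toℕ-fromℕ<)
open import Data.List using (List; []; _∷_; foldr; map; concatMap)
open import Data.List.Membership.Propositional using (_∈_; find)
open import Data.List.Membership.Propositional.Properties
  using (∈-map⁻; ∈-map⁺; ∈-++⁻; ∈-concatMap⁻; ∈-upTo⁻; ∈-upTo⁺)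
open import Data.List.Relation.Unary.Any as Any using (Any; here; there)
open import Data.List.Relation.Unary.Any.Properties using (map⁺)
open import Data.List.Relation.Unary.AllPairs using (AllPairs)
open import Data.Product using (_×_; _,_)
open import Data.Sum using (inj₁; inj₂)
open import Relation.Nullary using (¬_; yes; no; contradiction)
open import Relation.Binary.PropositionalEquality as ≡ using (_≡_)

∈-range⁻ : ∀ {a b n} → n ∈ range a b → a ≤ n × n ≤ b
∈-range⁻ {a} {b} n∈ with i , i∈ , ≡.refl ← ∈-map⁻ (a ℕ.+_) n∈ =
  ℕₚ.m≤m+n a i , a+i≤b a b i (∈-upTo⁻ i∈)
  where
  a+i≤b : ∀ a b i → i < suc b ∸ a → a ℕ.+ i ≤ b
  a+i≤b zero    b       i (s≤s i≤b) = i≤b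
  a+i≤b (suc a) (suc b) i i<        = s≤s (a+i≤b a b i i<)
  a+i≤b (suc a) zero    i i< with () ← ℕₚ.n≮0 (≡.subst (i <_) (ℕₚ.0∸n≡0 a) i<)

∈-range⁺ : ∀ {a b n} → a ≤ n → n ≤ b → n ∈ range a b
∈-range⁺ {a} {b} a≤n n≤b = ≡.subst (_∈ range a b) (ℕₚ.m+[n∸m]≡n a≤n)
  (∈-map⁺ (a ℕ.+_) (∈-upTo⁺ (ℕₚ.∸-monoˡ-< (s≤s n≤b) a≤n)))

propagate-≤ : ∀ {p} {P : ℕ → Set p} {lo hi} →
  (∀ j → lo ≤ j → j < hi → P j → P (suc j)) →
  ∀ {j k} → lo ≤ j → j ≤ k → k ≤ hi → P j → P k
propagate-≤ {P = P} {lo} {hi} step {j} lo≤j j≤k = go (ℕₚ.≤⇒≤′ j≤k)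
  where
  go : ∀ {k} → j ≤′ k → k ≤ hi → P j → P k
  go ≤′-refl         _    pj = pj
  go (≤′-step j≤′k) k<hi pj =
    step _ (ℕₚ.≤-trans lo≤j (ℕₚ.≤′⇒≤ j≤′k)) k<hi (go j≤′k (ℕₚ.<⇒≤ k<hi) pj)

module Congruence {c ℓ} (R : CommutativeRing c ℓ) where
  open CommutativeRing R
  open import Algebra.Properties.Ring ring
    using (-‿distribˡ-*; x[y-z]≈xy-xz; [y-z]x≈yx-zx; -0#≈0#)
  open import Algebra.Properties.AbelianGroup +-abelianGroup using (⁻¹-∙-comm)
  open import Algebra.Properties.CommutativeSemigroup +-commutativeSemigroup
    using (interchange)
  open import Algebra.Properties.Semiring.Divisibility semiring public
  open import Relation.Binary.Reasoning.Setoid setoid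

  ∣-+ : ∀ {d x y} → d ∣ x → d ∣ y → d ∣ x + y
  ∣-+ {d} (p , pd≈x) (q , qd≈y) = p + q , trans (distribʳ d p q) (+-cong pd≈x qd≈y)

  ∣-neg : ∀ {d x} → d ∣ x → d ∣ - x
  ∣-neg {d} (q , qd≈x) = - q , trans (sym (-‿distribˡ-* q d)) (-‿cong qd≈x)

  ∣-*ʳ : ∀ {d x} y → d ∣ x → d ∣ x * y
  ∣-*ʳ {x = x} y d∣x = ∣ʳ-respʳ-≈ (*-comm y x) (x∣ʳy⇒x∣ʳzy y d∣x)

  ∣-product : ∀ {d} xs → Any (d ∣_) xs → d ∣ foldr _*_ 1# xs
  ∣-product (x ∷ xs) (here d∣x)   = ∣-*ʳ (foldr _*_ 1# xs) d∣x
  ∣-product (x ∷ xs) (there d∣xs) = x∣ʳy⇒x∣ʳzy x (∣-product xs d∣xs)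

  infix 4 _≈_[mod_]
  _≈_[mod_] : Carrier → Carrier → Carrier → Set _
  x ≈ y [mod d ] = d ∣ x - y

  module _ {d : Carrier} where

    ∣⇒≈0[mod] : ∀ {x} → d ∣ x → x ≈ 0# [mod d ]
    ∣⇒≈0[mod] {x} = ∣ʳ-respʳ-≈ (begin
      x       ≈⟨ +-identityʳ x ⟨
      x + 0#  ≈⟨ +-congˡ -0#≈0# ⟨
      x - 0#  ∎)

    mod-refl : ∀ {x} → x ≈ x [mod d ]
    mod-refl {x} = ∣ʳ-respʳ-≈ (sym (-‿inverseʳ x)) (d ∣0)

    mod-trans : ∀ {x y z} → x ≈ y [mod d ] → y ≈ z [mod d ] → x ≈ z [mod d ]
    mod-trans {x} {y} {z} x≈y y≈z = ∣ʳ-respʳ-≈ (begin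
      (x - y) + (y - z)    ≈⟨ +-assoc x (- y) (y - z) ⟩
      x + (- y + (y - z))  ≈⟨ +-congˡ (+-assoc (- y) y (- z)) ⟨
      x + ((- y + y) - z)  ≈⟨ +-congˡ (+-congʳ (-‿inverseˡ y)) ⟩
      x + (0# - z)         ≈⟨ +-congˡ (+-identityˡ (- z)) ⟩
      x - z                ∎) (∣-+ x≈y y≈z)

    +-cong-mod : ∀ {x x′ y y′} →
      x ≈ x′ [mod d ] → y ≈ y′ [mod d ] → x + y ≈ x′ + y′ [mod d ]
    +-cong-mod {x} {x′} {y} {y′} x≈x′ y≈y′ = ∣ʳ-respʳ-≈ (begin
      (x - x′) + (y - y′)      ≈⟨ interchange x (- x′) y (- y′) ⟩
      (x + y) + (- x′ + - y′)  ≈⟨ +-congˡ (⁻¹-∙-comm x′ y′) ⟩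
      (x + y) - (x′ + y′)      ∎) (∣-+ x≈x′ y≈y′)

    -‿cong-mod : ∀ {x x′} → x ≈ x′ [mod d ] → - x ≈ - x′ [mod d ]
    -‿cong-mod {x} {x′} x≈x′ = ∣ʳ-respʳ-≈ (sym (⁻¹-∙-comm x (- x′))) (∣-neg x≈x′)

    *-cong-mod : ∀ {x x′ y y′} →
      x ≈ x′ [mod d ] → y ≈ y′ [mod d ] → x * y ≈ x′ * y′ [mod d ]
    *-cong-mod {x} {x′} {y} {y′} x≈x′ y≈y′ = mod-trans
      (∣ʳ-respʳ-≈ ([y-z]x≈yx-zx y x x′) (∣-*ʳ y x≈x′))
      (∣ʳ-respʳ-≈ (x[y-z]≈xy-xz x′ y y′) (x∣ʳy⇒x∣ʳzy x′ y≈y′))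

    product-cong-mod : ∀ {a} {A : Set a} (f g : A → Carrier) xs →
      (∀ {e} → e ∈ xs → f e ≈ g e [mod d ]) →
      foldr _*_ 1# (map f xs) ≈ foldr _*_ 1# (map g xs) [mod d ]
    product-cong-mod f g []       _   = mod-refl
    product-cong-mod f g (x ∷ xs) f≈g =
      *-cong-mod (f≈g (here ≡.refl)) (product-cong-mod f g xs (λ e∈xs → f≈g (there e∈xs)))

module PolynomialRing {c ℓ′} (K : Field c ℓ′) (m : ℕ) where
  open Poly K

  commutativeRing : CommutativeRing c (c ⊔ ℓ′)
  commutativeRing = record
    { Carrier = P m ; _≈_ = _≋_ ; _+_ = _⊕_ ; _*_ = _⊗_ ; -_ = ⊝_ ; 0# = 𝟘 ; 1# = 𝟙
    ; isCommutativeRing = record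
      { isRing = record
        { +-isAbelianGroup = record
          { isGroup = record
            { isMonoid = record
              { isSemigroup = record
                { isMagma = record
                  { isEquivalence = record { refl = ≋-refl ; sym = ≋-sym ; trans = ≋-trans }
                  ; ∙-cong = ⊕-cong }
                ; assoc = ⊕-assoc }
              ; identity = ⊕-idˡ , ⊕-idʳ }
            ; inverse = (λ p → ≋-trans (⊕-comm _ _) (⊝-invʳ p)) , ⊝-invʳ
            ; ⁻¹-cong = ⊝-cong }
          ; comm = ⊕-comm }
        ; *-cong = ⊗-cong
        ; *-assoc = ⊗-assoc
        ; *-identity = ⊗-idˡ , ⊗-idʳ
        ; distrib = ⊗-distribˡ , λ r p q → ⊗-distribʳ p q r }
      ; *-comm = ⊗-comm } }
    where
    ⊕-idˡ : ∀ (p : P m) → 𝟘 ⊕ p ≋ p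
    ⊕-idˡ p = ≋-trans (⊕-comm _ _) (⊕-idʳ p)
    ⊗-idˡ : ∀ (p : P m) → 𝟙 ⊗ p ≋ p
    ⊗-idˡ p = ≋-trans (⊗-comm _ _) (⊗-idʳ p)
    ⊗-distribˡ : ∀ (p q r : P m) → p ⊗ (q ⊕ r) ≋ (p ⊗ q) ⊕ (p ⊗ r)
    ⊗-distribˡ p q r =
      ≋-trans (⊗-comm _ _) (≋-trans (⊗-distribʳ q r p) (⊕-cong (⊗-comm _ _) (⊗-comm _ _)))

  open CommutativeRing commutativeRing using (zeroˡ; +-identityˡ)
  open Congruence commutativeRing using (_∣_; _,_)

  ∣⇒∈⟨⟩ : ∀ {d f : P m} → d ∣ f → f ∈⟨ d ⟩
  ∣⇒∈⟨⟩ {d} (q , qd≋f) = q , ≋-trans (≋-sym qd≋f) (⊗-comm q d)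

  apply-con-⊗ : ∀ (θ : Der m) a p → apply θ (con a ⊗ p) ≋ con a ⊗ apply θ p
  apply-con-⊗ θ a p = ≋-trans (⊕-cong (zeroˡ p) ≋-refl) (+-identityˡ _)

module Arrangement {c ℓ′} (K : Field c ℓ′) (ℓ : ℕ) (N : ℕ → List (Field.Carrier K)) where
  open Field K using (Carrier) renaming (_≈_ to _≈ᴷ_; reflexive to ≈ᴷ-reflexive)
  open IN K ℓ
  open PolynomialRing K (suc ℓ)
  open CommutativeRing commutativeRing
    using (setoid; ring; zeroʳ; +-identityˡ) renaming (reflexive to ≋-reflexive)
  open import Algebra.Properties.Ring ring using (-0#≈0#)
  open Congruence commutativeRing
  open import Relation.Binary.Reasoning.Setoid setoid

  α₁ : ℕ → Carrier → S
  α₁ j a = (x 1 ⊖ x j) ⊖ (con a ⊗ z)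

  α : ℕ → ℕ → S
  α i j = x i ⊖ x j

  data Hyperplane : S → Set c where
    z-hyperplane  : Hyperplane z
    α₁-hyperplane : ∀ {j a} → 2 ≤ j → j ≤ ℓ → a ∈ N j → Hyperplane (α₁ j a)
    α-hyperplane  : ∀ {i j} → 2 ≤ i → i < j → j ≤ ℓ → Hyperplane (α i j)

  hyperplane : ∀ {f} → f ∈ arrangement N → Hyperplane f
  hyperplane (here ≡.refl) = z-hyperplane
  hyperplane (there f∈) with ∈-++⁻ (concatMap (λ j → map (α₁ j) (N j)) (range 2 ℓ)) f∈
  ... | inj₁ f∈α₁
        with j , j∈ , f∈α₁ⱼ ← find (∈-concatMap⁻ (λ j → map (α₁ j) (N j)) {xs = range 2 ℓ} f∈α₁)
        with a , a∈ , ≡.refl ← ∈-map⁻ (α₁ j) f∈α₁ⱼ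
        with 2≤j , j≤ℓ ← ∈-range⁻ j∈
    = α₁-hyperplane 2≤j j≤ℓ a∈
  ... | inj₂ f∈α
        with j , j∈ , f∈αⱼ ← find (∈-concatMap⁻ (λ j → map (λ i → α i j) (range 2 (j ∸ 1)))
                                                  {xs = range 2 ℓ} f∈α)
        with i , i∈ , ≡.refl ← ∈-map⁻ (λ i → α i j) f∈αⱼ
        with s≤s (s≤s _) , j≤ℓ ← ∈-range⁻ {2} {ℓ} j∈
        with 2≤i , i≤j∸1 ← ∈-range⁻ {2} {j ∸ 1} i∈
    = α-hyperplane 2≤i (s≤s i≤j∸1) j≤ℓ

  ∈D-arrangement : ∀ {θ} → (∀ {f} → Hyperplane f → f ∣ apply θ f) → θ ∈D arrangement N
  ∈D-arrangement tangent f f∈ = ∣⇒∈⟨⟩ (tangent (hyperplane f∈))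

  x≡var : ∀ {j} (j<1+ℓ : j < suc ℓ) → x j ≡ var (fromℕ< j<1+ℓ)
  x≡var {j} j<1+ℓ with j <? suc ℓ
  ... | yes _     = ≡.refl
  ... | no  j≮1+ℓ = contradiction j<1+ℓ j≮1+ℓ

  1<1+ℓ : ∀ {j} → 2 ≤ j → j ≤ ℓ → 1 < suc ℓ
  1<1+ℓ 2≤j j≤ℓ = ℕₚ.m≤n⇒m≤1+n (ℕₚ.≤-trans 2≤j j≤ℓ)

  i<1+ℓ : ∀ {i j} → i < j → j ≤ ℓ → i < suc ℓ
  i<1+ℓ i<j j≤ℓ = ℕₚ.m≤n⇒m≤1+n (ℕₚ.≤-trans i<j j≤ℓ)

  apply-α₁ : ∀ (θ : Der (suc ℓ)) j a {u v} → apply θ (x 1) ≡ u → apply θ (x j) ≡ v →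
    apply θ (α₁ j a) ≋ (u ⊖ v) ⊖ (con a ⊗ apply θ z)
  apply-α₁ θ j a ≡.refl ≡.refl = ⊕-cong ≋-refl (⊝-cong (apply-con-⊗ θ a z))

  apply-α : ∀ (θ : Der (suc ℓ)) i j {u v} → apply θ (x i) ≡ u → apply θ (x j) ≡ v →
    apply θ (α i j) ≡ u ⊖ v
  apply-α θ i j ≡.refl ≡.refl = ≡.refl

  θ₀-x : ∀ {j} → 1 ≤ j → j < suc ℓ → apply (θ₀ N) (x j) ≡ 𝟙
  θ₀-x (s≤s _) j<1+ℓ rewrite x≡var j<1+ℓ = ≡.refl

  θ₀-tangent : ∀ {f} → Hyperplane f → f ∣ apply (θ₀ N) f
  θ₀-tangent z-hyperplane = z ∣0
  θ₀-tangent (α₁-hyperplane {j} {a} 2≤j j≤ℓ _) = ∣ʳ-respʳ-≈ (≋-sym (begin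
    apply (θ₀ N) (α₁ j a)
      ≈⟨ apply-α₁ (θ₀ N) j a (θ₀-x ℕₚ.≤-refl (1<1+ℓ 2≤j j≤ℓ)) (θ₀-x (ℕₚ.<⇒≤ 2≤j) (s≤s j≤ℓ)) ⟩
    (𝟙 ⊖ 𝟙) ⊖ (con a ⊗ 𝟘)  ≈⟨ ⊕-cong (⊝-invʳ 𝟙) (⊝-cong (zeroʳ (con a))) ⟩
    𝟘 ⊖ 𝟘                  ≈⟨ ⊝-invʳ 𝟘 ⟩
    𝟘                      ∎)) (α₁ j a ∣0)
  θ₀-tangent (α-hyperplane {i} {j} 2≤i i<j j≤ℓ) = ∣ʳ-respʳ-≈ (≋-sym (begin
    apply (θ₀ N) (α i j)
      ≡⟨ apply-α (θ₀ N) i j (θ₀-x (ℕₚ.<⇒≤ 2≤i) (i<1+ℓ i<j j≤ℓ))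
                            (θ₀-x (ℕₚ.<⇒≤ (ℕₚ.<-trans 2≤i i<j)) (s≤s j≤ℓ)) ⟩
    𝟙 ⊖ 𝟙  ≈⟨ ⊝-invʳ 𝟙 ⟩
    𝟘      ∎)) (α i j ∣0)

  θ₁-x : ∀ j → apply (θ₁ N) (x j) ≡ x j
  θ₁-x j with j <? suc ℓ
  ... | yes _ = ≡.refl
  ... | no  _ = ≡.refl

  θ₁-tangent : ∀ {f} → Hyperplane f → f ∣ apply (θ₁ N) f
  θ₁-tangent z-hyperplane = ∣ʳ-refl
  θ₁-tangent (α₁-hyperplane {j} {a} _ _ _) =
    ∣ʳ-reflexive (≋-sym (apply-α₁ (θ₁ N) j a (θ₁-x 1) (θ₁-x j)))
  θ₁-tangent (α-hyperplane {i} {j} _ _ _) =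
    ∣ʳ-reflexive (≋-reflexive (≡.sym (apply-α (θ₁ N) i j (θ₁-x i) (θ₁-x j))))

  Q : ℕ → ℕ → S
  Q k s = prod (map (α₁ s) (N k)) ⊗ prod (map (α s) (range (suc k) ℓ))

  coeff : ℕ → ℕ → S
  coeff k s with 2 ≤? s | s ≤? k
  ... | yes _ | yes _ = Q k s
  ... | _     | _     = 𝟘

  θ≡coeff : ∀ k i → θ N k i ≡ coeff k (toℕ i)
  θ≡coeff k i with toℕ i
  ... | s with 2 ≤? s | s ≤? k
  ...   | yes _ | yes _ = ≡.refl
  ...   | yes _ | no  _ = ≡.refl
  ...   | no  _ | _     = ≡.refl

  θ-x : ∀ k {s} → s < suc ℓ → apply (θ N k) (x s) ≡ coeff k s
  θ-x k s<1+ℓ rewrite x≡var s<1+ℓ =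
    ≡.trans (θ≡coeff k _) (≡.cong (coeff k) (toℕ-fromℕ< s<1+ℓ))

  coeff-Q : ∀ {k s} → 2 ≤ s → s ≤ k → coeff k s ≡ Q k s
  coeff-Q {k} {s} 2≤s s≤k with 2 ≤? s | s ≤? k
  ... | yes _   | yes _   = ≡.refl
  ... | yes _   | no  s≰k = contradiction s≤k s≰k
  ... | no  2≰s | _       = contradiction 2≤s 2≰s

  coeff-beyond : ∀ {k s} → k < s → coeff k s ≡ 𝟘
  coeff-beyond {k} {s} k<s with 2 ≤? s | s ≤? k
  ... | yes _ | yes s≤k = contradiction s≤k (ℕₚ.<⇒≱ k<s)
  ... | yes _ | no  _   = ≡.refl
  ... | no  _ | _       = ≡.refl

  Q-congruent : ∀ k i j → Q k i ≈ Q k j [mod α i j ]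
  Q-congruent k i j = *-cong-mod
    (product-cong-mod (α₁ i) (α₁ j) (N k)
      (λ _ → +-cong-mod (+-cong-mod mod-refl (-‿cong-mod xᵢ≈xⱼ)) mod-refl))
    (product-cong-mod (α i) (α j) (range (suc k) ℓ) (λ _ → +-cong-mod xᵢ≈xⱼ mod-refl))
    where
    xᵢ≈xⱼ : x i ≈ x j [mod α i j ]
    xᵢ≈xⱼ = ∣ʳ-refl

  coeff-congruent : ∀ {k i j} → 2 ≤ i → i < j → j ≤ ℓ → coeff k i ≈ coeff k j [mod α i j ]
  coeff-congruent {k} {i} {j} 2≤i i<j j≤ℓ with k <? j | k <? i
  ... | no k≮j | _ =
    ≡.subst₂ (_≈_[mod α i j ]) (≡.sym (coeff-Q 2≤i (ℕₚ.≤-trans (ℕₚ.<⇒≤ i<j) j≤k)))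
                               (≡.sym (coeff-Q (ℕₚ.≤-trans 2≤i (ℕₚ.<⇒≤ i<j)) j≤k))
      (Q-congruent k i j)
    where
    j≤k : j ≤ k
    j≤k = ℕₚ.≮⇒≥ k≮j
  ... | yes k<j | no k≮i =
    ≡.subst₂ (_≈_[mod α i j ]) (≡.sym (coeff-Q 2≤i (ℕₚ.≮⇒≥ k≮i))) (≡.sym (coeff-beyond k<j))
      (∣⇒≈0[mod] (x∣ʳy⇒x∣ʳzy _ (∣-product _
        (map⁺ (Any.map (λ { ≡.refl → ∣ʳ-refl }) (∈-range⁺ k<j j≤ℓ))))))
  ... | yes k<j | yes k<i =
    ≡.subst₂ (_≈_[mod α i j ]) (≡.sym (coeff-beyond k<i)) (≡.sym (coeff-beyond k<j)) mod-refl

  module _ (N-step : ∀ j → 2 ≤ j → j < ℓ → ∀ a →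
                     Any (a ≈ᴷ_) (N j) → Any (a ≈ᴷ_) (N (suc j))) where

    N-nested : ∀ {a j k} → 2 ≤ j → j ≤ k → k ≤ ℓ → Any (a ≈ᴷ_) (N j) → Any (a ≈ᴷ_) (N k)
    N-nested {a} = propagate-≤ (λ j 2≤j j<ℓ → N-step j 2≤j j<ℓ a)

    α₁∣coeff : ∀ {k j a} → k ≤ ℓ → 2 ≤ j → a ∈ N j → α₁ j a ∣ coeff k j
    α₁∣coeff {k} {j} {a} k≤ℓ 2≤j a∈Nⱼ with k <? j
    ... | yes k<j = ≡.subst (α₁ j a ∣_) (≡.sym (coeff-beyond k<j)) (α₁ j a ∣0)
    ... | no  k≮j = ≡.subst (α₁ j a ∣_) (≡.sym (coeff-Q 2≤j j≤k))
      (∣-*ʳ _ (∣-product _ (map⁺ (Any.map α₁∣α₁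
        (N-nested 2≤j j≤k k≤ℓ (Any.map ≈ᴷ-reflexive a∈Nⱼ))))))
      where
      j≤k : j ≤ k
      j≤k = ℕₚ.≮⇒≥ k≮j
      α₁∣α₁ : ∀ {b} → a ≈ᴷ b → α₁ j a ∣ α₁ j b
      α₁∣α₁ a≈b = ∣ʳ-reflexive (⊕-cong ≋-refl (⊝-cong (⊗-cong (con-cong a≈b) ≋-refl)))

    θ-tangent : ∀ {k f} → k ≤ ℓ → Hyperplane f → f ∣ apply (θ N k) f
    θ-tangent k≤ℓ z-hyperplane = z ∣0
    θ-tangent {k} k≤ℓ (α₁-hyperplane {j} {a} 2≤j j≤ℓ a∈Nⱼ) = ∣ʳ-respʳ-≈ (≋-sym (begin
      apply (θ N k) (α₁ j a)
        ≈⟨ apply-α₁ (θ N k) j a (θ-x k (1<1+ℓ 2≤j j≤ℓ)) (θ-x k (s≤s j≤ℓ)) ⟩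
      (𝟘 ⊖ coeff k j) ⊖ (con a ⊗ 𝟘)  ≈⟨ ⊕-cong (+-identityˡ _) (⊝-cong (zeroʳ (con a))) ⟩
      (⊝ coeff k j) ⊖ 𝟘              ≈⟨ ⊕-cong ≋-refl -0#≈0# ⟩
      (⊝ coeff k j) ⊕ 𝟘              ≈⟨ ⊕-idʳ _ ⟩
      ⊝ coeff k j                    ∎)) (∣-neg (α₁∣coeff k≤ℓ 2≤j a∈Nⱼ))
    θ-tangent {k} k≤ℓ (α-hyperplane {i} {j} 2≤i i<j j≤ℓ) =
      ≡.subst (α i j ∣_) (≡.sym (apply-α (θ N k) i j (θ-x k (i<1+ℓ i<j j≤ℓ)) (θ-x k (s≤s j≤ℓ))))
        (coeff-congruent 2≤i i<j j≤ℓ)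

lemma4p1 : ∀ {c ℓ′ : Level} (K : Field c ℓ′) → CharZero K →
    (ℓ : ℕ) → 2 ≤ ℓ →
    (N : ℕ → List (Field.Carrier K)) →
    (∀ j → 2 ≤ j → j ≤ ℓ → AllPairs (λ a b → ¬ Field._≈_ K a b) (N j)) →
    (∀ j → 2 ≤ j → j < ℓ → ∀ a →
       Any (Field._≈_ K a) (N j) → Any (Field._≈_ K a) (N (suc j))) →
    let open IN K ℓ in
      (θ₀ N ∈D arrangement N)
      × (θ₁ N ∈D arrangement N)
      × (∀ k → 2 ≤ k → k ≤ ℓ → θ N k ∈D arrangement N)
lemma4p1 K _ ℓ _ N _ N-step =
    ∈D-arrangement θ₀-tangent
  , ∈D-arrangement θ₁-tangent
  , λ k _ k≤ℓ → ∈D-arrangement (θ-tangent N-step k≤ℓ)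
  where open Arrangement K ℓ N
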